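{- Let $\mathbf{G}=\mathbf{GL}_r$ (split) over $S$, with its diagonal maximal torus and upper triangular Borel subgroup, and let $\tilde{\mathbf{G}}$ be a degree $n$ cover of $\mathbf{G}$ with first Brylinski–Deligne invariant $Q_{1,c}$ for an integer $c$. If $\gcd(n,1+r+2rc)=1$, then the dual group $\tilde{\mathbb{G}}^\vee$ is isomorphic to $\mathbb{GL}_r$. If $\gcd(n,r)=1$, then the derived subgroup of $\tilde{\mathbb{G}}^\vee$ is isomorphic to $\mathbb{SL}_r$, and thus there exists an isogeny $\tilde{\mathbb{G}}^\vee\to\mathbb{GL}_r$.
   Context: $S$ is $\operatorname{Spec}$ of a field or of a DVR (containing a field or with finite residue field) whose residue fields all have exactly $n$ $n$-th roots of unity. Identify the cocharacter lattice of the diagonal torus with $Y=\mathbb{Z}^r$. For integers $q,c$, $Q_{q,c}$ is the unique Weyl-invariant quadratic form on $Y$ with $Q(1,-1,0,\dots,0)=q$ and $Q(1,0,\dots,0)=1+c$. A degree $n$ cover is a Brylinski–Deligne central extension of $\mathbf{G}$ by $\mathbf{K}_2$ together with $n$; its first invariant is a Weyl-invariant quadratic form on $Y$. The dual group $\tilde{\mathbb{G}}^\vee$ is the pinned split reductive group over $\mathbb{Z}$ with based root datum $(Y_{Q,n},\tilde\Phi^\vee,\tilde\Delta^\vee,X_{Q,n},\tilde\Phi,\tilde\Delta)$, where $\beta_Q(y_1,y_2)=n^{ -1}(Q(y_1+y_2)-Q(y_1)-Q(y_2))$, $Y_{Q,n}=\{y\in Y:\beta_Q(y,Y)\subset\mathbb{Z}\}$,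 $X_{Q,n}=\{x\in n^{ -1}X:\langle x,Y_{Q,n}\rangle\subset\mathbb{Z}\}$, and for each root $\phi$, $n_\phi=n/\gcd(n,Q(\phi^\vee))$, $\tilde\phi=n_\phi^{ -1}\phi$, $\tilde\phi^\vee=n_\phi\phi^\vee$. -}

module Defs where

open import Data.Nat as ℕ using (ℕ; zero; suc; NonZero; ≢-nonZero)
open import Data.Nat.GCD using (gcd; gcd[m,n]≢0)
open import Data.Integer as ℤ using (ℤ; +_; ∣_∣)
open import Data.Rational as ℚ using (ℚ; _+_; _*_; -_; _-_; 0ℚ; 1ℚ)
open import Data.Fin using (Fin; zero; suc; toℕ)
open import Data.Product using (Σ; ∃; ∃-syntax; _×_; _,_)
open import Data.Sum using (inj₁)
open import Relation.Binary.PropositionalEquality using (_≡_; _≢_)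
open import Relation.Nullary using (¬_; yes; no)

V : ℕ → Set
V r = Fin r → ℚ

ι : ℤ → ℚ
ι z = z ℚ./ 1

_≋_ : ∀ {r} → V r → V r → Set
u ≋ v = ∀ i → u i ≡ v i

_+ᵥ_ : ∀ {r} → V r → V r → V r
(u +ᵥ v) i = u i + v i

_·ᵥ_ : ∀ {r} → ℚ → V r → V r
(a ·ᵥ v) i = a * v i

∑ : ∀ {r} → (Fin r → ℚ) → ℚ
∑ {zero}  f = 0ℚ
∑ {suc r} f = f zero + ∑ {r} (λ i → f (suc i))

-- standard pairing between ℚ^r and ℚ^r (X ⊗ Y → ℤ extended to ℚ)
⟪_,_⟫ : ∀ {r} → V r → V r → ℚ
⟪ u , v ⟫ = ∑ (λ i → u i * v i)

IsInt : ∀ {r} → V r → Set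
IsInt v = ∀ i → ∃[ z ] v i ≡ ι z

IsIntℚ : ℚ → Set
IsIntℚ a = ∃[ z ] a ≡ ι z

e : ∀ {r} → Fin r → V r
e i j with i Data.Fin.≟ j
... | yes _ = 1ℚ
... | no  _ = 0ℚ

α : ∀ {r} → Fin r → Fin r → V r
α i j = e i +ᵥ ((- 1ℚ) ·ᵥ e j)

-- Root data, with character and cocharacter lattices realised as
-- subsets of ℚ^r and the pairing given by ⟪_,_⟫.

record RootDatum (r : ℕ) : Set₁ where
  field
    X    : V r → Set
    Φ    : V r → Set
    Y    : V r → Set
    Φ∨   : V r → Set
open RootDatum public

Additive : ∀ {r} → (V r → V r) → Set
Additive f = ∀ u v → f (u +ᵥ v) ≋ (f u +ᵥ f v)

LatticeIso : ∀ {r} → (V r → Set) → (V r → Set) → (V r → V r) → Set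
LatticeIso L₁ L₂ f =
  (∀ u → L₁ u → L₂ (f u)) ×
  Σ (_ → _) (λ g → (∀ v → L₂ v → L₁ (g v)) ×
                   (∀ u → L₁ u → g (f u) ≋ u) ×
                   (∀ v → L₂ v → f (g v) ≋ v))

MapsOnto : ∀ {r} → (V r → Set) → (V r → Set) → (V r → V r) → Set
MapsOnto S₁ S₂ f = (∀ u → S₁ u → S₂ (f u)) × (∀ v → S₂ v → ∃[ u ] (S₁ u × f u ≋ v))

RootDatumIso : ∀ {r} → RootDatum r → RootDatum r → Set
RootDatumIso D₁ D₂ =
  Σ (_ → _) λ f → Σ (_ → _) λ f∨ →
    Additive f × Additive f∨ ×
    LatticeIso (X D₁) (X D₂) f × LatticeIso (Y D₂) (Y D₁) f∨ ×
    (∀ x y → X D₁ x → Y D₂ y → ⟪ f x , y ⟫ ≡ ⟪ x , f∨ y ⟫) ×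
    MapsOnto (Φ D₁) (Φ D₂) f × MapsOnto (Φ∨ D₂) (Φ∨ D₁) f∨

-- (Central) isogeny G₁ → G₂ in terms of root data: an injective map
-- f : X₂ → X₁ with finite cokernel, with transpose f∨ : Y₁ → Y₂,
-- such that f(Φ₂) = Φ₁ and f∨(Φ₁∨) = Φ₂∨.
Isogeny : ∀ {r} → RootDatum r → RootDatum r → Set
Isogeny D₁ D₂ =
  Σ (_ → _) λ f → Σ (_ → _) λ f∨ →
    Additive f × Additive f∨ ×
    (∀ x → X D₂ x → X D₁ (f x)) ×
    (∀ x x' → X D₂ x → X D₂ x' → f x ≋ f x' → x ≋ x') ×
    (Σ ℕ λ N → NonZero N × (∀ x → X D₁ x → ∃[ x' ] (X D₂ x' × f x' ≋ ((ι (+ N)) ·ᵥ x)))) ×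
    (∀ y → Y D₁ y → Y D₂ (f∨ y)) ×
    (∀ x y → X D₂ x → Y D₁ y → ⟪ f x , y ⟫ ≡ ⟪ x , f∨ y ⟫) ×
    MapsOnto (Φ D₂) (Φ D₁) f × MapsOnto (Φ∨ D₁) (Φ∨ D₂) f∨

IsRootA : ∀ {r} → V r → Set
IsRootA {r} v = Σ (Fin r) λ i → Σ (Fin r) λ j → i ≢ j × v ≋ α i j

GLDatum : (r : ℕ) → RootDatum r
GLDatum r = record { X = IsInt ; Φ = IsRootA ; Y = IsInt ; Φ∨ = IsRootA }

-- For the root data below the coroots span the
-- sum-zero hyperplane H ⊂ ℚ^r; the derived subgroup has cocharacter
-- lattice Y ∩ H and character lattice the image of X in Hom(H,ℚ),
-- which is identified with H via ⟪_,_⟫, i.e. the orthogonal projection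
-- π(X) of X onto H.
π : ∀ {r} .{{_ : NonZero r}} → V r → V r
π {r} v i = v i - (∑ v * ((+ 1) ℚ./ r))

InH : ∀ {r} → V r → Set
InH v = ∑ v ≡ 0ℚ

Derived : ∀ {r} .{{_ : NonZero r}} → RootDatum r → RootDatum r
Derived D = record
  { X  = λ v → ∃[ x ] (X D x × v ≋ π x)
  ; Φ  = λ v → ∃[ a ] (Φ D a × v ≋ π a)
  ; Y  = λ y → Y D y × InH y
  ; Φ∨ = Φ∨ D }

SLDatum : (r : ℕ) .{{_ : NonZero r}} → RootDatum r
SLDatum r = Derived (GLDatum r)

-- The quadratic form Q_{q,c} on Y = ℤ^r (extended to ℚ^r):
--   Q(y) = (1+c) Σ_i y_i² + (1+2c+ (1-q)) Σ_{i<j} y_i y_j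
-- i.e. the Weyl-invariant form with Q(e₁-e₂) = q, Q(e₁) = 1+c.

∑<  : ∀ {r} → V r → ℚ
∑< {r} y = ∑ (λ i → ∑ (λ j → lt i j))
  where
  lt : Fin r → Fin r → ℚ
  lt i j with toℕ i ℕ.<? toℕ j
  ... | yes _ = y i * y j
  ... | no  _ = 0ℚ

Qform : ∀ {r} → ℤ → ℤ → V r → ℚ
Qform q c y = (ι (ℤ.+ 1 ℤ.+ c)) * ∑ (λ i → y i * y i)
            + (ι ((ℤ.+ 2) ℤ.* (ℤ.+ 1 ℤ.+ c) ℤ.- q)) * ∑< y

βQ : ∀ {r} (n : ℕ) .{{_ : NonZero n}} → ℤ → ℤ → V r → V r → ℚ
βQ n q c y₁ y₂ = (Qform q c (y₁ +ᵥ y₂) - Qform q c y₁ - Qform q c y₂) * ((+ 1) ℚ./ n)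

YQn : ∀ {r} (n : ℕ) .{{_ : NonZero n}} → ℤ → ℤ → V r → Set
YQn n q c y = IsInt y × (∀ y' → IsInt y' → IsIntℚ (βQ n q c y y'))

XQn : ∀ {r} (n : ℕ) .{{_ : NonZero n}} → ℤ → ℤ → V r → Set
XQn n q c x = IsInt ((ι (+ n)) ·ᵥ x) × (∀ y → YQn n q c y → IsIntℚ ⟪ x , y ⟫)

-- n_φ = n / gcd(n, Q(φ∨)); Q(φ∨) = Q_{q,c}(e_i - e_j) = q for every root φ
nφ : (n : ℕ) .{{_ : NonZero n}} → ℤ → ℕ
nφ n@(suc m) q = ℕ._/_ n (gcd n ∣ q ∣)
  {{≢-nonZero (gcd[m,n]≢0 n ∣ q ∣ (inj₁ λ ()))}}

-- The dual group's root datum (Y_{Q,n}, Φ̃∨, X_{Q,n}, Φ̃):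
-- character lattice Y_{Q,n}, roots φ̃∨ = n_φ φ∨,
-- cocharacter lattice X_{Q,n}, coroots φ̃ = n_φ⁻¹ φ.
DualDatum : (r n : ℕ) .{{_ : NonZero n}} → ℤ → ℤ → RootDatum r
DualDatum r n q c = record
  { X  = YQn n q c
  ; Φ  = λ v → ∃[ a ] (IsRootA a × v ≋ (ι (+ nφ n q) ·ᵥ a))
  ; Y  = XQn n q c
  ; Φ∨ = λ v → ∃[ a ] (IsRootA a × v ≋ (((+ gcd n ∣ q ∣) ℚ./ n) ·ᵥ a)) }

{-# OPTIONS --safe #-}
module Submission where

-- For Q = Q_{1,c} the polar form is ⟪ y , y′ ⟫ + (1 + 2c) ∑ y ∑ y′, so y ∈ ℤʳ lies in Y_{Q,n}
-- iff n divides y_j + (1 + 2c) ∑ y for every j. Hence all y_j are congruent mod n, and then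
-- ∑ y ≡ r y₀ gives n ∣ (1 + r + 2rc) y₀. So Y_{Q,n} = nℤʳ when n is prime to 1 + r + 2rc,
-- X_{Q,n} = n⁻¹ℤʳ, and since n_φ = n for every root, multiplication by n⁻¹ identifies the dual
-- root datum with that of GL_r. For arbitrary n one still has Y_{Q,n} ⊆ nℤʳ + ℤ(1,…,1), and the
-- extra line disappears under the projection to the sum-zero hyperplane and pairs to zero with
-- it; so the same scaling identifies the derived datum with that of SL_r, and multiplication
-- by n is an isogeny onto GL_r.

open import Defs
open import Data.Nat using (ℕ; NonZero)
open import Data.Nat.GCD using (gcd)
open import Data.Integer using (ℤ; +_; ∣_∣)
open import Data.Product using (_×_; _,_; proj₁; ∃-syntax)
open import Relation.Binary.PropositionalEquality using (_≡_)

-- The rational operators are opened only inside this module: the statement at the end uses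
-- the integer ones under the same names.
module _ where
  open import Data.Nat as ℕ using ()
  open import Data.Nat.Properties using (_<?_; nonZero?)
  open import Relation.Nullary.Decidable using (recompute)
  open import Data.Nat.GCD using (GCD; gcd-GCD; gcd-zeroʳ; gcd[m,n]≢0; module Bézout)
  open import Data.Nat.DivMod using (/-congʳ; n/1≡n)
  import Data.Integer as ℤ
  import Data.Integer.Properties as ℤ
  open import Data.Rational using (ℚ; 0ℚ; 1ℚ; _+_; _*_; _-_; -_; _/_; fromℚᵘ; toℚᵘ)
  import Data.Rational.Properties as ℚ
  open import Data.Rational.Unnormalised as ℚᵘ using (mkℚᵘ; *≡*)
  import Data.Rational.Unnormalised.Properties as ℚᵘ
  open import Data.Integer.Tactic.RingSolver using (solve-∀)
  open import Data.Rational.Solver using (module +-*-Solver)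
  open +-*-Solver using (solve; _:+_; _:*_; :-_; _:-_; _:=_; con)
  open import Data.Fin using (Fin; zero; suc; toℕ; _≟_)
  open import Data.Vec.Functional using (tail)
  open import Data.Bool using (if_then_else_)
  open import Relation.Nullary using (does; yes; no)
  open import Data.Sum using (inj₁)
  open import Function using (const; it)
  open import Relation.Binary.PropositionalEquality
    using (refl; sym; trans; cong; cong₂; subst; module ≡-Reasoning)

  -- ι z and ⅟ (suc m) are definitionally fromℚᵘ (mkℚᵘ z 0) and fromℚᵘ (mkℚᵘ (+ 1) m).
  fromℚᵘ-homo-+ : ∀ p q → fromℚᵘ (p ℚᵘ.+ q) ≡ fromℚᵘ p + fromℚᵘ q
  fromℚᵘ-homo-+ p q = ℚ.toℚᵘ-injective (begin-equality
    toℚᵘ (fromℚᵘ (p ℚᵘ.+ q))               ≃⟨ ℚ.toℚᵘ-fromℚᵘ (p ℚᵘ.+ q) ⟩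
    p ℚᵘ.+ q                                ≃⟨ ℚᵘ.+-cong (back p) (back q) ⟩
    toℚᵘ (fromℚᵘ p) ℚᵘ.+ toℚᵘ (fromℚᵘ q)   ≃⟨ ℚ.toℚᵘ-homo-+ (fromℚᵘ p) (fromℚᵘ q) ⟨
    toℚᵘ (fromℚᵘ p + fromℚᵘ q)              ∎)
    where
    open ℚᵘ.≤-Reasoning
    back : ∀ x → x ℚᵘ.≃ toℚᵘ (fromℚᵘ x)
    back x = ℚᵘ.≃-sym (ℚ.toℚᵘ-fromℚᵘ x)

  fromℚᵘ-homo-* : ∀ p q → fromℚᵘ (p ℚᵘ.* q) ≡ fromℚᵘ p * fromℚᵘ q
  fromℚᵘ-homo-* p q = ℚ.toℚᵘ-injective (begin-equality
    toℚᵘ (fromℚᵘ (p ℚᵘ.* q))               ≃⟨ ℚ.toℚᵘ-fromℚᵘ (p ℚᵘ.* q) ⟩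
    p ℚᵘ.* q                                ≃⟨ ℚᵘ.*-cong (back p) (back q) ⟩
    toℚᵘ (fromℚᵘ p) ℚᵘ.* toℚᵘ (fromℚᵘ q)   ≃⟨ ℚ.toℚᵘ-homo-* (fromℚᵘ p) (fromℚᵘ q) ⟨
    toℚᵘ (fromℚᵘ p * fromℚᵘ q)              ∎)
    where
    open ℚᵘ.≤-Reasoning
    back : ∀ x → x ℚᵘ.≃ toℚᵘ (fromℚᵘ x)
    back x = ℚᵘ.≃-sym (ℚ.toℚᵘ-fromℚᵘ x)

  fromℚᵘ-homo‿- : ∀ p → fromℚᵘ (ℚᵘ.- p) ≡ - fromℚᵘ p
  fromℚᵘ-homo‿- p = ℚ.toℚᵘ-injective (begin-equality
    toℚᵘ (fromℚᵘ (ℚᵘ.- p))    ≃⟨ ℚ.toℚᵘ-fromℚᵘ (ℚᵘ.- p) ⟩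
    ℚᵘ.- p                     ≃⟨ ℚᵘ.-‿cong (ℚᵘ.≃-sym (ℚ.toℚᵘ-fromℚᵘ p)) ⟩
    ℚᵘ.- toℚᵘ (fromℚᵘ p)      ≃⟨ ℚ.toℚᵘ-homo‿- (fromℚᵘ p) ⟨
    toℚᵘ (- fromℚᵘ p)          ∎)
    where open ℚᵘ.≤-Reasoning

  ι-homo-+ : ∀ a b → ι (a ℤ.+ b) ≡ ι a + ι b
  ι-homo-+ a b = trans (ℚ.fromℚᵘ-cong ι[a+b]≃ι[a]+ι[b]) (fromℚᵘ-homo-+ (mkℚᵘ a 0) (mkℚᵘ b 0))
    where
    ι[a+b]≃ι[a]+ι[b] : mkℚᵘ (a ℤ.+ b) 0 ℚᵘ.≃ mkℚᵘ a 0 ℚᵘ.+ mkℚᵘ b 0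
    ι[a+b]≃ι[a]+ι[b] = *≡* (cong (ℤ._* + 1) (sym (cong₂ ℤ._+_ (ℤ.*-identityʳ a) (ℤ.*-identityʳ b))))

  ι-homo-* : ∀ a b → ι (a ℤ.* b) ≡ ι a * ι b
  ι-homo-* a b = fromℚᵘ-homo-* (mkℚᵘ a 0) (mkℚᵘ b 0)

  ι-homo‿- : ∀ a → ι (ℤ.- a) ≡ - ι a
  ι-homo‿- a = fromℚᵘ-homo‿- (mkℚᵘ a 0)

  ι-pos-+ : ∀ m n → ι (+ (m ℕ.+ n)) ≡ ι (+ m) + ι (+ n)
  ι-pos-+ m n = trans (cong ι (ℤ.pos-+ m n)) (ι-homo-+ (+ m) (+ n))

  ι-pos-* : ∀ m n → ι (+ (m ℕ.* n)) ≡ ι (+ m) * ι (+ n)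
  ι-pos-* m n = trans (cong ι (ℤ.pos-* m n)) (ι-homo-* (+ m) (+ n))

  ⅟ : (n : ℕ) .{{_ : NonZero n}} → ℚ
  ⅟ n = + 1 / n

  ιn*⅟n≡1 : ∀ n .{{_ : NonZero n}} → ι (+ n) * ⅟ n ≡ 1ℚ
  ιn*⅟n≡1 (ℕ.suc m) = trans (sym (fromℚᵘ-homo-* (mkℚᵘ (+ ℕ.suc m) 0) (mkℚᵘ (+ 1) m)))
                            (ℚ.fromℚᵘ-cong (ℚᵘ.*-inverseʳ (mkℚᵘ (+ ℕ.suc m) 0)))

  ⅟n*ιn≡1 : ∀ n .{{_ : NonZero n}} → ⅟ n * ι (+ n) ≡ 1ℚ
  ⅟n*ιn≡1 n = trans (ℚ.*-comm (⅟ n) (ι (+ n))) (ιn*⅟n≡1 n)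

  *-inverse-cancel : ∀ a b → a * b ≡ 1ℚ → ∀ x → a * (b * x) ≡ x
  *-inverse-cancel a b ab≡1 x = begin
    a * (b * x)   ≡⟨ ℚ.*-assoc a b x ⟨
    a * b * x     ≡⟨ cong (_* x) ab≡1 ⟩
    1ℚ * x        ≡⟨ ℚ.*-identityˡ x ⟩
    x             ∎
    where open ≡-Reasoning

  isInt-+ : ∀ {a b} → IsIntℚ a → IsIntℚ b → IsIntℚ (a + b)
  isInt-+ (x , refl) (y , refl) = x ℤ.+ y , sym (ι-homo-+ x y)

  isInt-* : ∀ {a b} → IsIntℚ a → IsIntℚ b → IsIntℚ (a * b)
  isInt-* (x , refl) (y , refl) = x ℤ.* y , sym (ι-homo-* x y)

  isInt-neg : ∀ {a} → IsIntℚ a → IsIntℚ (- a)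
  isInt-neg (x , refl) = ℤ.- x , sym (ι-homo‿- x)

  isInt-minus : ∀ {a b} → IsIntℚ a → IsIntℚ b → IsIntℚ (a - b)
  isInt-minus p q = isInt-+ p (isInt-neg q)

  isInt-+-cancelʳ : ∀ {a b} → IsIntℚ (a + b) → IsIntℚ b → IsIntℚ a
  isInt-+-cancelʳ {a} {b} a+b-int b-int =
    subst IsIntℚ (solve 2 (λ a b → a :+ b :- b := a) refl a b) (isInt-minus a+b-int b-int)

  isInt-ι : ∀ z → IsIntℚ (ι z)
  isInt-ι z = z , refl

  isInt-bezout : ∀ {a b w} x y → 1 ℕ.+ y ℕ.* b ≡ x ℕ.* a →
                 IsIntℚ (ι (+ a) * w) → IsIntℚ (ι (+ b) * w) → IsIntℚ w
  isInt-bezout {a} {b} {w} x y 1+yb≡xa aw bw =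
    subst IsIntℚ combination≡w (isInt-minus (isInt-* (isInt-ι (+ x)) aw) (isInt-* (isInt-ι (+ y)) bw))
    where
    open ≡-Reasoning
    xa≡1+yb : ι (+ x) * ι (+ a) ≡ 1ℚ + ι (+ y) * ι (+ b)
    xa≡1+yb = begin
      ι (+ x) * ι (+ a)           ≡⟨ ι-pos-* x a ⟨
      ι (+ (x ℕ.* a))             ≡⟨ cong (λ k → ι (+ k)) (sym 1+yb≡xa) ⟩
      ι (+ (1 ℕ.+ y ℕ.* b))       ≡⟨ ι-pos-+ 1 (y ℕ.* b) ⟩
      1ℚ + ι (+ (y ℕ.* b))        ≡⟨ cong (λ t → 1ℚ + t) (ι-pos-* y b) ⟩
      1ℚ + ι (+ y) * ι (+ b)      ∎
    combination≡w : ι (+ x) * (ι (+ a) * w) - ι (+ y) * (ι (+ b) * w) ≡ w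
    combination≡w = begin
      ι (+ x) * (ι (+ a) * w) - ι (+ y) * (ι (+ b) * w)
        ≡⟨ solve 5 (λ X A Y B W → X :* (A :* W) :- Y :* (B :* W) := X :* A :* W :- Y :* B :* W) refl
                   (ι (+ x)) (ι (+ a)) (ι (+ y)) (ι (+ b)) w ⟩
      ι (+ x) * ι (+ a) * w - ι (+ y) * ι (+ b) * w
        ≡⟨ cong (λ t → t * w - ι (+ y) * ι (+ b) * w) xa≡1+yb ⟩
      (1ℚ + ι (+ y) * ι (+ b)) * w - ι (+ y) * ι (+ b) * w
        ≡⟨ solve 2 (λ P W → (con 1ℚ :+ P) :* W :- P :* W := W) refl (ι (+ y) * ι (+ b)) w ⟩
      w ∎

  isInt-coprime : ∀ m n {w} → gcd m n ≡ 1 → IsIntℚ (ι (+ m) * w) → IsIntℚ (ι (+ n) * w) → IsIntℚ w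
  isInt-coprime m n gcd≡1 mw nw with Bézout.identity (subst (GCD m n) gcd≡1 (gcd-GCD m n))
  ... | Bézout.+- x y eq = isInt-bezout x y eq mw nw
  ... | Bézout.-+ x y eq = isInt-bezout y x eq nw mw

  isInt-∣∣* : ∀ g {w} → IsIntℚ (ι g * w) → IsIntℚ (ι (+ ∣ g ∣) * w)
  isInt-∣∣* (+ k)        gw = gw
  isInt-∣∣* g@(ℤ.-[1+ k ]) {w} gw =
    subst IsIntℚ (trans (ℚ.neg-distribˡ-* (ι g) w) (cong (_* w) (sym (ι-homo‿- g)))) (isInt-neg gw)

  ∑-cong : ∀ {r} {f g : Fin r → ℚ} → (∀ i → f i ≡ g i) → ∑ f ≡ ∑ g
  ∑-cong {ℕ.zero}  f≗g = refl
  ∑-cong {ℕ.suc r} f≗g = cong₂ _+_ (f≗g zero) (∑-cong (λ i → f≗g (suc i)))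

  ∑-+ : ∀ {r} (f g : Fin r → ℚ) → ∑ (λ i → f i + g i) ≡ ∑ f + ∑ g
  ∑-+ {ℕ.zero}  f g = refl
  ∑-+ {ℕ.suc r} f g = begin
    f zero + g zero + ∑ (λ i → f (suc i) + g (suc i))
      ≡⟨ cong (λ t → f zero + g zero + t) (∑-+ (tail f) (tail g)) ⟩
    f zero + g zero + (∑ (tail f) + ∑ (tail g))
      ≡⟨ solve 4 (λ a b s t → a :+ b :+ (s :+ t) := a :+ s :+ (b :+ t)) refl (f zero) (g zero) (∑ (tail f)) (∑ (tail g)) ⟩
    f zero + ∑ (tail f) + (g zero + ∑ (tail g))
      ∎
    where open ≡-Reasoning

  *-distribˡ-∑ : ∀ {r} a (f : Fin r → ℚ) → a * ∑ f ≡ ∑ (λ i → a * f i)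
  *-distribˡ-∑ {ℕ.zero}  a f = ℚ.*-zeroʳ a
  *-distribˡ-∑ {ℕ.suc r} a f = trans (ℚ.*-distribˡ-+ a (f zero) (∑ (tail f)))
                                     (cong (λ t → a * f zero + t) (*-distribˡ-∑ a (tail f)))

  ∑-const : ∀ {r} a → ∑ {r} (const a) ≡ ι (+ r) * a
  ∑-const {ℕ.zero}  a = sym (ℚ.*-zeroˡ a)
  ∑-const {ℕ.suc r} a = begin
    a + ∑ {r} (const a)     ≡⟨ cong (λ t → a + t) (∑-const {r} a) ⟩
    a + ι (+ r) * a         ≡⟨ solve 2 (λ a x → a :+ x :* a := (con 1ℚ :+ x) :* a) refl a (ι (+ r)) ⟩
    (1ℚ + ι (+ r)) * a      ≡⟨ cong (_* a) (ι-pos-+ 1 r) ⟨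
    ι (+ ℕ.suc r) * a       ∎
    where open ≡-Reasoning

  isInt-∑ : ∀ {r} {f : Fin r → ℚ} → (∀ i → IsIntℚ (f i)) → IsIntℚ (∑ f)
  isInt-∑ {ℕ.zero}  f-int = isInt-ι (+ 0)
  isInt-∑ {ℕ.suc r} f-int = isInt-+ (f-int zero) (isInt-∑ (λ i → f-int (suc i)))

  isInt-⟪⟫ : ∀ {r} {u v : V r} → IsInt u → IsInt v → IsIntℚ ⟪ u , v ⟫
  isInt-⟪⟫ u-int v-int = isInt-∑ (λ i → isInt-* (u-int i) (v-int i))

  ⟪⟫-congʳ : ∀ {r} (u : V r) {v w : V r} → v ≋ w → ⟪ u , v ⟫ ≡ ⟪ u , w ⟫
  ⟪⟫-congʳ u v≋w = ∑-cong (λ i → cong (u i *_) (v≋w i))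

  ⟪⟫-·ᵥˡ : ∀ {r} a (u v : V r) → ⟪ a ·ᵥ u , v ⟫ ≡ a * ⟪ u , v ⟫
  ⟪⟫-·ᵥˡ a u v = trans (∑-cong (λ i → ℚ.*-assoc a (u i) (v i))) (sym (*-distribˡ-∑ a (λ i → u i * v i)))

  ·ᵥ-self-adjoint : ∀ {r} a (u v : V r) → ⟪ a ·ᵥ u , v ⟫ ≡ ⟪ u , a ·ᵥ v ⟫
  ·ᵥ-self-adjoint a u v = ∑-cong (λ i → solve 3 (λ a x y → a :* x :* y := x :* (a :* y)) refl a (u i) (v i))

  ⟪⟫-+ᵥʳ : ∀ {r} (u v w : V r) → ⟪ u , v +ᵥ w ⟫ ≡ ⟪ u , v ⟫ + ⟪ u , w ⟫
  ⟪⟫-+ᵥʳ u v w = trans (∑-cong (λ i → ℚ.*-distribˡ-+ (u i) (v i) (w i))) (∑-+ (λ i → u i * v i) (λ i → u i * w i))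

  ⟪⟫-+const : ∀ {r} (u v : V r) a → InH u → ⟪ u , v +ᵥ const a ⟫ ≡ ⟪ u , v ⟫
  ⟪⟫-+const u v a ∑u≡0 = begin
    ⟪ u , v +ᵥ const a ⟫           ≡⟨ ⟪⟫-+ᵥʳ u v (const a) ⟩
    ⟪ u , v ⟫ + ⟪ u , const a ⟫    ≡⟨ cong (λ t → ⟪ u , v ⟫ + t) (∑-cong (λ i → ℚ.*-comm (u i) a)) ⟩
    ⟪ u , v ⟫ + ∑ (a ·ᵥ u)         ≡⟨ cong (λ t → ⟪ u , v ⟫ + t) (sym (*-distribˡ-∑ a u)) ⟩
    ⟪ u , v ⟫ + a * ∑ u            ≡⟨ cong (λ s → ⟪ u , v ⟫ + a * s) ∑u≡0 ⟩
    ⟪ u , v ⟫ + a * 0ℚ             ≡⟨ cong (λ t → ⟪ u , v ⟫ + t) (ℚ.*-zeroʳ a) ⟩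
    ⟪ u , v ⟫ + 0ℚ                 ≡⟨ ℚ.+-identityʳ ⟪ u , v ⟫ ⟩
    ⟪ u , v ⟫                      ∎
    where open ≡-Reasoning

  δ : ∀ {r} → Fin r → Fin r → ℚ
  δ i j = if does (i ≟ j) then 1ℚ else 0ℚ

  e≡δ : ∀ {r} (i j : Fin r) → e i j ≡ δ i j
  e≡δ i j with i ≟ j
  ... | yes _ = refl
  ... | no _  = refl

  ∑-*δ : ∀ {r} (f : Fin r → ℚ) j → ∑ (λ i → f i * δ j i) ≡ f j
  ∑-*δ {ℕ.suc r} f zero = begin
    f zero * 1ℚ + ∑ (λ i → f (suc i) * 0ℚ)
      ≡⟨ cong₂ _+_ (ℚ.*-identityʳ (f zero)) (∑-cong (λ i → ℚ.*-zeroʳ (f (suc i)))) ⟩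
    f zero + ∑ {r} (const 0ℚ)
      ≡⟨ cong (λ t → f zero + t) (trans (∑-const {r} 0ℚ) (ℚ.*-zeroʳ (ι (+ r)))) ⟩
    f zero + 0ℚ
      ≡⟨ ℚ.+-identityʳ (f zero) ⟩
    f zero
      ∎
    where open ≡-Reasoning
  ∑-*δ {ℕ.suc r} f (suc j) = trans (cong₂ _+_ (ℚ.*-zeroʳ (f zero)) (∑-*δ (tail f) j)) (ℚ.+-identityˡ (f (suc j)))

  ⟪⟫-e : ∀ {r} (y : V r) j → ⟪ y , e j ⟫ ≡ y j
  ⟪⟫-e y j = trans (∑-cong (λ i → cong (y i *_) (e≡δ j i))) (∑-*δ y j)

  ∑-e : ∀ {r} (j : Fin r) → ∑ (e j) ≡ 1ℚ
  ∑-e j = trans (∑-cong (λ i → sym (ℚ.*-identityˡ (e j i)))) (⟪⟫-e (const 1ℚ) j)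

  isInt-e : ∀ {r} (i j : Fin r) → IsIntℚ (e i j)
  isInt-e i j with i ≟ j
  ... | yes _ = isInt-ι (+ 1)
  ... | no _  = isInt-ι (+ 0)

  -- Through does, upper y (suc i) (suc j) and upper (tail y) i j are definitionally equal.
  upper : ∀ {r} → V r → Fin r → Fin r → ℚ
  upper y i j = if does (toℕ i <? toℕ j) then y i * y j else 0ℚ

  mutual
    ∑<≡∑∑upper : ∀ {r} (y : V r) → ∑< y ≡ ∑ (λ i → ∑ (λ j → upper y i j))
    ∑<≡∑∑upper y = ∑-cong (λ i → ∑-cong (λ j → ∑<-entry y i j))

    -- The left-hand side is the (i , j) entry of ∑< y, which is local to Defs and can only
    -- be named through unification with the use above.
    ∑<-entry : ∀ {r} (y : V r) (i j : Fin r) → _ ≡ upper y i j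
    ∑<-entry y i j with toℕ i <? toℕ j in eq
    ... | yes _ = cong (λ d → if does d then y i * y j else 0ℚ) (sym eq)
    ... | no _  = cong (λ d → if does d then y i * y j else 0ℚ) (sym eq)

  ∑<-suc : ∀ {r} (y : V (ℕ.suc r)) → ∑< y ≡ y zero * ∑ (tail y) + ∑< (tail y)
  ∑<-suc {r} y = begin
    ∑< y
      ≡⟨ ∑<≡∑∑upper y ⟩
    0ℚ + ∑ (λ j → y zero * tail y j) + ∑ (λ i → 0ℚ + ∑ (λ j → upper (tail y) i j))
      ≡⟨ cong₂ _+_ (trans (ℚ.+-identityˡ _) (sym (*-distribˡ-∑ (y zero) (tail y))))
                   (trans (∑-cong {r} (λ i → ℚ.+-identityˡ _)) (sym (∑<≡∑∑upper (tail y)))) ⟩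
    y zero * ∑ (tail y) + ∑< (tail y)
      ∎
    where open ≡-Reasoning

  ∑<-+ᵥ : ∀ {r} (y y′ : V r) → ∑< (y +ᵥ y′) ≡ ∑< y + ∑< y′ + (∑ y * ∑ y′ - ⟪ y , y′ ⟫)
  ∑<-+ᵥ {ℕ.zero}  y y′ = refl
  ∑<-+ᵥ {ℕ.suc r} y y′ = begin
    ∑< (y +ᵥ y′)
      ≡⟨ ∑<-suc (y +ᵥ y′) ⟩
    (a + a′) * ∑ (tail y +ᵥ tail y′) + ∑< (tail y +ᵥ tail y′)
      ≡⟨ cong₂ (λ s l → (a + a′) * s + l) (∑-+ (tail y) (tail y′)) (∑<-+ᵥ (tail y) (tail y′)) ⟩
    (a + a′) * (t + t′) + (l + l′ + (t * t′ - p))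
      ≡⟨ solve 7 (λ a a′ t t′ l l′ p → (a :+ a′) :* (t :+ t′) :+ (l :+ l′ :+ (t :* t′ :- p))
                    := a :* t :+ l :+ (a′ :* t′ :+ l′) :+ ((a :+ t) :* (a′ :+ t′) :- (a :* a′ :+ p)))
                 refl a a′ t t′ l l′ p ⟩
    a * t + l + (a′ * t′ + l′) + ((a + t) * (a′ + t′) - (a * a′ + p))
      ≡⟨ cong₂ (λ s s′ → s + s′ + ((a + t) * (a′ + t′) - (a * a′ + p))) (sym (∑<-suc y)) (sym (∑<-suc y′)) ⟩
    ∑< y + ∑< y′ + (∑ y * ∑ y′ - ⟪ y , y′ ⟫)
      ∎
    where
    open ≡-Reasoning
    a a′ t t′ l l′ p : ℚ
    a  = y zero
    a′ = y′ zero
    t  = ∑ (tail y)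
    t′ = ∑ (tail y′)
    l  = ∑< (tail y)
    l′ = ∑< (tail y′)
    p  = ⟪ tail y , tail y′ ⟫

  ⟪⟫-+ᵥ-square : ∀ {r} (y y′ : V r) →
                 ⟪ y +ᵥ y′ , y +ᵥ y′ ⟫ ≡ ⟪ y , y ⟫ + ⟪ y′ , y′ ⟫ + (⟪ y , y′ ⟫ + ⟪ y , y′ ⟫)
  ⟪⟫-+ᵥ-square y y′ = begin
    ⟪ y +ᵥ y′ , y +ᵥ y′ ⟫
      ≡⟨ ∑-cong (λ i → solve 2 (λ a b → (a :+ b) :* (a :+ b) := a :* a :+ b :* b :+ (a :* b :+ a :* b)) refl (y i) (y′ i)) ⟩
    ∑ (λ i → y i * y i + y′ i * y′ i + (y i * y′ i + y i * y′ i))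
      ≡⟨ ∑-+ (λ i → y i * y i + y′ i * y′ i) (λ i → y i * y′ i + y i * y′ i) ⟩
    ∑ (λ i → y i * y i + y′ i * y′ i) + ∑ (λ i → y i * y′ i + y i * y′ i)
      ≡⟨ cong₂ _+_ (∑-+ (λ i → y i * y i) (λ i → y′ i * y′ i)) (∑-+ (λ i → y i * y′ i) (λ i → y i * y′ i)) ⟩
    ⟪ y , y ⟫ + ⟪ y′ , y′ ⟫ + (⟪ y , y′ ⟫ + ⟪ y , y′ ⟫)
      ∎
    where open ≡-Reasoning

  b₁₂ : ℤ → ℤ → ℤ
  b₁₂ q c = + 2 ℤ.* (+ 1 ℤ.+ c) ℤ.- q

  BQ : ∀ {r} → ℤ → ℤ → V r → V r → ℚ
  BQ q c y y′ = ι q * ⟪ y , y′ ⟫ + ι (b₁₂ q c) * (∑ y * ∑ y′)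

  2[1+c]-b₁₂≡q : ∀ q c → ι (+ 1 ℤ.+ c) + ι (+ 1 ℤ.+ c) - ι (b₁₂ q c) ≡ ι q
  2[1+c]-b₁₂≡q q c = begin
    A + A - ι (b₁₂ q c)
      ≡⟨ cong (λ x → A + A - x) (ι-homo-+ (+ 2 ℤ.* (+ 1 ℤ.+ c)) (ℤ.- q)) ⟩
    A + A - (ι (+ 2 ℤ.* (+ 1 ℤ.+ c)) + ι (ℤ.- q))
      ≡⟨ cong₂ (λ x z → A + A - (x + z)) (ι-homo-* (+ 2) (+ 1 ℤ.+ c)) (ι-homo‿- q) ⟩
    A + A - (ι (+ 2) * A + - ι q)
      ≡⟨ solve 2 (λ A Q → A :+ A :- (con (1ℚ + 1ℚ) :* A :+ :- Q) := Q) refl A (ι q) ⟩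
    ι q
      ∎
    where
    open ≡-Reasoning
    A : ℚ
    A = ι (+ 1 ℤ.+ c)

  Qform-polarisation : ∀ {r} q c (y y′ : V r) →
                       Qform q c (y +ᵥ y′) - Qform q c y - Qform q c y′ ≡ BQ q c y y′
  Qform-polarisation q c y y′ = begin
    A * ⟪ y +ᵥ y′ , y +ᵥ y′ ⟫ + B * ∑< (y +ᵥ y′) - (A * P + B * L) - (A * P′ + B * L′)
      ≡⟨ cong₂ (λ s l → A * s + B * l - (A * P + B * L) - (A * P′ + B * L′)) (⟪⟫-+ᵥ-square y y′) (∑<-+ᵥ y y′) ⟩
    A * (P + P′ + (I + I)) + B * (L + L′ + (S * S′ - I)) - (A * P + B * L) - (A * P′ + B * L′)
      ≡⟨ solve 9 (λ A B P P′ I L L′ S S′ →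
                    A :* (P :+ P′ :+ (I :+ I)) :+ B :* (L :+ L′ :+ (S :* S′ :- I)) :- (A :* P :+ B :* L) :- (A :* P′ :+ B :* L′)
                    := (A :+ A :- B) :* I :+ B :* (S :* S′))
                 refl A B P P′ I L L′ S S′ ⟩
    (A + A - B) * I + B * (S * S′)
      ≡⟨ cong (λ x → x * I + B * (S * S′)) (2[1+c]-b₁₂≡q q c) ⟩
    BQ q c y y′
      ∎
    where
    open ≡-Reasoning
    A B P P′ I L L′ S S′ : ℚ
    A  = ι (+ 1 ℤ.+ c)
    B  = ι (b₁₂ q c)
    P  = ⟪ y , y ⟫
    P′ = ⟪ y′ , y′ ⟫
    I  = ⟪ y , y′ ⟫
    L  = ∑< y
    L′ = ∑< y′
    S  = ∑ y
    S′ = ∑ y′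

  BQ-·ᵥˡ : ∀ {r} q c a (y y′ : V r) → BQ q c (a ·ᵥ y) y′ ≡ a * BQ q c y y′
  BQ-·ᵥˡ q c a y y′ = begin
    ι q * ⟪ a ·ᵥ y , y′ ⟫ + ι (b₁₂ q c) * (∑ (a ·ᵥ y) * ∑ y′)
      ≡⟨ cong₂ (λ p s → ι q * p + ι (b₁₂ q c) * (s * ∑ y′)) (⟪⟫-·ᵥˡ a y y′) (sym (*-distribˡ-∑ a y)) ⟩
    ι q * (a * ⟪ y , y′ ⟫) + ι (b₁₂ q c) * (a * ∑ y * ∑ y′)
      ≡⟨ solve 6 (λ Q B a p s s′ → Q :* (a :* p) :+ B :* (a :* s :* s′) := a :* (Q :* p :+ B :* (s :* s′)))
                 refl (ι q) (ι (b₁₂ q c)) a ⟪ y , y′ ⟫ (∑ y) (∑ y′) ⟩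
    a * BQ q c y y′
      ∎
    where open ≡-Reasoning

  isInt-BQ : ∀ {r} q c {y y′ : V r} → IsInt y → IsInt y′ → IsIntℚ (BQ q c y y′)
  isInt-BQ q c y-int y′-int =
    isInt-+ (isInt-* (isInt-ι q) (isInt-⟪⟫ y-int y′-int))
            (isInt-* (isInt-ι (b₁₂ q c)) (isInt-* (isInt-∑ y-int) (isInt-∑ y′-int)))

  BQ-e : ∀ {r} q c (y : V r) j → BQ q c y (e j) ≡ ι q * y j + ι (b₁₂ q c) * ∑ y
  BQ-e q c y j = trans (cong₂ (λ p s → ι q * p + ι (b₁₂ q c) * (∑ y * s)) (⟪⟫-e y j) (∑-e j))
                       (cong (λ x → ι q * y j + ι (b₁₂ q c) * x) (ℚ.*-identityʳ (∑ y)))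

  π-cong : ∀ {r} .{{_ : NonZero r}} {u v : V r} → u ≋ v → π u ≋ π v
  π-cong {r} u≋v i = cong₂ (λ x s → x - s * ⅟ r) (u≋v i) (∑-cong u≋v)

  π-·ᵥ : ∀ {r} .{{_ : NonZero r}} a (v : V r) → π (a ·ᵥ v) ≋ (a ·ᵥ π v)
  π-·ᵥ {r} a v i = trans (cong (λ s → a * v i - s * ⅟ r) (sym (*-distribˡ-∑ a v)))
                         (solve 4 (λ a x s u → a :* x :- a :* s :* u := a :* (x :- s :* u)) refl a (v i) (∑ v) (⅟ r))

  π-+const : ∀ {r} .{{_ : NonZero r}} (v : V r) a → π (v +ᵥ const a) ≋ π v
  π-+const {r} v a i = begin
    v i + a - ∑ (v +ᵥ const a) * ⅟ r
      ≡⟨ cong (λ s → v i + a - s * ⅟ r) (trans (∑-+ v (const a)) (cong (λ s → ∑ v + s) (∑-const {r} a))) ⟩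
    v i + a - (∑ v + ι (+ r) * a) * ⅟ r
      ≡⟨ solve 5 (λ x a s n u → x :+ a :- (s :+ n :* a) :* u := x :- s :* u :+ a :* (con 1ℚ :- n :* u))
                 refl (v i) a (∑ v) (ι (+ r)) (⅟ r) ⟩
    v i - ∑ v * ⅟ r + a * (1ℚ - ι (+ r) * ⅟ r)
      ≡⟨ cong (λ t → v i - ∑ v * ⅟ r + a * (1ℚ - t)) (ιn*⅟n≡1 r) ⟩
    v i - ∑ v * ⅟ r + a * (1ℚ - 1ℚ)
      ≡⟨ solve 2 (λ x a → x :+ a :* (con 1ℚ :- con 1ℚ) := x) refl (v i - ∑ v * ⅟ r) a ⟩
    π v i
      ∎
    where open ≡-Reasoning

  ·ᵥ-additive : ∀ {r} a → Additive {r} (a ·ᵥ_)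
  ·ᵥ-additive a u v i = ℚ.*-distribˡ-+ a (u i) (v i)

  ·ᵥ-inverse : ∀ {r} a b → a * b ≡ 1ℚ → (u : V r) → (a ·ᵥ (b ·ᵥ u)) ≋ u
  ·ᵥ-inverse a b ab≡1 u i = *-inverse-cancel a b ab≡1 (u i)

  ·ᵥ-injective : ∀ {r} a b {u v : V r} → b * a ≡ 1ℚ → (a ·ᵥ u) ≋ (a ·ᵥ v) → u ≋ v
  ·ᵥ-injective a b {u} {v} ba≡1 au≋av i =
    trans (sym (·ᵥ-inverse b a ba≡1 u i)) (trans (cong (b *_) (au≋av i)) (·ᵥ-inverse b a ba≡1 v i))

  InH-·ᵥ : ∀ {r} a (v : V r) → InH v → InH (a ·ᵥ v)
  InH-·ᵥ a v ∑v≡0 = trans (sym (*-distribˡ-∑ a v)) (trans (cong (a *_) ∑v≡0) (ℚ.*-zeroʳ a))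

  ·ᵥ-latticeIso : ∀ {r} {L₁ L₂ : V r → Set} a b → a * b ≡ 1ℚ →
                  (∀ u → L₁ u → L₂ (a ·ᵥ u)) → (∀ v → L₂ v → L₁ (b ·ᵥ v)) → LatticeIso L₁ L₂ (a ·ᵥ_)
  ·ᵥ-latticeIso a b ab≡1 L₁→L₂ L₂→L₁ =
    L₁→L₂ , (b ·ᵥ_) , L₂→L₁ ,
    (λ u _ → ·ᵥ-inverse b a (trans (ℚ.*-comm b a) ab≡1) u) , (λ v _ → ·ᵥ-inverse a b ab≡1 v)

  Scaled : ∀ {r} → ℚ → (V r → Set) → V r → Set
  Scaled b S v = ∃[ s ] (S s × v ≋ (b ·ᵥ s))

  ·ᵥ-onto-unscaled : ∀ {r} {S : V r → Set} a b → a * b ≡ 1ℚ → (∀ {u v} → u ≋ v → S u → S v) →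
                     MapsOnto (Scaled b S) S (a ·ᵥ_)
  ·ᵥ-onto-unscaled {S = S} a b ab≡1 S-resp-≋ = unscale , rescale
    where
    unscale : ∀ u → Scaled b S u → S (a ·ᵥ u)
    unscale u (s , s∈S , u≋bs) = S-resp-≋ (λ i → sym (trans (cong (a *_) (u≋bs i)) (·ᵥ-inverse a b ab≡1 s i))) s∈S
    rescale : ∀ v → S v → ∃[ u ] (Scaled b S u × (a ·ᵥ u) ≋ v)
    rescale v v∈S = b ·ᵥ v , (v , v∈S , λ i → refl) , ·ᵥ-inverse a b ab≡1 v

  ·ᵥ-onto-scaled : ∀ {r} {S : V r → Set} a b → a ≡ b → MapsOnto S (Scaled b S) (a ·ᵥ_)
  ·ᵥ-onto-scaled a .a refl =
    (λ u u∈S → u , u∈S , λ i → refl) , (λ v (s , s∈S , v≋as) → s , s∈S , λ i → sym (v≋as i))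

  IsRootA-resp-≋ : ∀ {r} {u v : V r} → u ≋ v → IsRootA u → IsRootA v
  IsRootA-resp-≋ u≋v (i , j , i≢j , u≋αij) = i , j , i≢j , λ k → trans (sym (u≋v k)) (u≋αij k)

  Projected : ∀ {r} .{{_ : NonZero r}} → (V r → Set) → V r → Set
  Projected S v = ∃[ s ] (S s × v ≋ π s)

  π-onto : ∀ {r} .{{_ : NonZero r}} {S₁ S₂ : V r → Set} a →
           MapsOnto S₁ S₂ (a ·ᵥ_) → MapsOnto (Projected S₁) (Projected S₂) (a ·ᵥ_)
  π-onto {S₁ = S₁} {S₂} a (S₁→S₂ , S₂←S₁) = project , lift
    where
    project : ∀ u → Projected S₁ u → Projected S₂ (a ·ᵥ u)
    project u (s , s∈S₁ , u≋πs) =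
      a ·ᵥ s , S₁→S₂ s s∈S₁ , λ i → trans (cong (a *_) (u≋πs i)) (sym (π-·ᵥ a s i))
    lift : ∀ w → Projected S₂ w → ∃[ u ] (Projected S₁ u × (a ·ᵥ u) ≋ w)
    lift w (t , t∈S₂ , w≋πt) with S₂←S₁ t t∈S₂
    ... | s , s∈S₁ , as≋t = π s , (s , s∈S₁ , λ i → refl) ,
                            λ i → trans (sym (π-·ᵥ a s i)) (trans (π-cong as≋t i) (sym (w≋πt i)))

  nφ[n,1]≡n : ∀ n .{{_ : NonZero n}} → nφ n (+ 1) ≡ n
  nφ[n,1]≡n n@(ℕ.suc _) =
    trans (/-congʳ {{ℕ.≢-nonZero (gcd[m,n]≢0 n 1 (inj₁ λ ()))}} (gcd-zeroʳ n)) (n/1≡n n)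

  gcd[n,1]/n≡⅟n : ∀ n .{{_ : NonZero n}} → (+ gcd n ∣ + 1 ∣) / n ≡ ⅟ n
  gcd[n,1]/n≡⅟n n = cong (λ k → + k / n) (gcd-zeroʳ n)

  1+r+2rc : ℤ → ℕ → ℤ
  1+r+2rc c r = + 1 ℤ.+ + r ℤ.+ + 2 ℤ.* + r ℤ.* c

  ι[1+r+2rc]≡1+b₁₂r : ∀ c r → ι (1+r+2rc c r) ≡ ι (+ 1) + ι (b₁₂ (+ 1) c) * ι (+ r)
  ι[1+r+2rc]≡1+b₁₂r c r = begin
    ι (1+r+2rc c r)                        ≡⟨ cong ι (1+x+2xc≡1+b₁₂x (+ r) c) ⟩
    ι (+ 1 ℤ.+ b₁₂ (+ 1) c ℤ.* + r)        ≡⟨ ι-homo-+ (+ 1) (b₁₂ (+ 1) c ℤ.* + r) ⟩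
    ι (+ 1) + ι (b₁₂ (+ 1) c ℤ.* + r)      ≡⟨ cong (λ x → ι (+ 1) + x) (ι-homo-* (b₁₂ (+ 1) c) (+ r)) ⟩
    ι (+ 1) + ι (b₁₂ (+ 1) c) * ι (+ r)    ∎
    where
    open ≡-Reasoning
    1+x+2xc≡1+b₁₂x : ∀ x d → + 1 ℤ.+ x ℤ.+ + 2 ℤ.* x ℤ.* d ≡ + 1 ℤ.+ (+ 2 ℤ.* (+ 1 ℤ.+ d) ℤ.- + 1) ℤ.* x
    1+x+2xc≡1+b₁₂x = solve-∀

  module _ (n : ℕ) .{{_ : NonZero n}} (c : ℤ) where

    YQ XQ : ∀ {r} → V r → Set
    YQ = YQn n (+ 1) c
    XQ = XQn n (+ 1) c

    K : ℚ
    K = ι (b₁₂ (+ 1) c)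

    βQ≡⅟n*BQ : ∀ {r} (y y′ : V r) → βQ n (+ 1) c y y′ ≡ ⅟ n * BQ (+ 1) c y y′
    βQ≡⅟n*BQ y y′ = trans (cong (_* ⅟ n) (Qform-polarisation (+ 1) c y y′)) (ℚ.*-comm (BQ (+ 1) c y y′) (⅟ n))

    nℤʳ⊆YQ : ∀ {r} {z : V r} → IsInt z → YQ (ι (+ n) ·ᵥ z)
    nℤʳ⊆YQ {z = z} z-int = (λ i → isInt-* (isInt-ι (+ n)) (z-int i)) ,
                           λ y′ y′-int → subst IsIntℚ (sym (βQ[nz,y′]≡BQ[z,y′] y′)) (isInt-BQ (+ 1) c z-int y′-int)
      where
      βQ[nz,y′]≡BQ[z,y′] : ∀ y′ → βQ n (+ 1) c (ι (+ n) ·ᵥ z) y′ ≡ BQ (+ 1) c z y′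
      βQ[nz,y′]≡BQ[z,y′] y′ = begin
        βQ n (+ 1) c (ι (+ n) ·ᵥ z) y′       ≡⟨ βQ≡⅟n*BQ (ι (+ n) ·ᵥ z) y′ ⟩
        ⅟ n * BQ (+ 1) c (ι (+ n) ·ᵥ z) y′   ≡⟨ cong (⅟ n *_) (BQ-·ᵥˡ (+ 1) c (ι (+ n)) z y′) ⟩
        ⅟ n * (ι (+ n) * BQ (+ 1) c z y′)    ≡⟨ *-inverse-cancel (⅟ n) (ι (+ n)) (⅟n*ιn≡1 n) (BQ (+ 1) c z y′) ⟩
        BQ (+ 1) c z y′                      ∎
        where open ≡-Reasoning

    YQ-βQ[y,e] : ∀ {r} {y : V r} → YQ y → ∀ j → IsIntℚ (⅟ n * (ι (+ 1) * y j + K * ∑ y))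
    YQ-βQ[y,e] {y = y} (_ , β-int) j =
      subst IsIntℚ (trans (βQ≡⅟n*BQ y (e j)) (cong (⅟ n *_) (BQ-e (+ 1) c y j))) (β-int (e j) (isInt-e j))

    reduced : ∀ {r} → V (ℕ.suc r) → V (ℕ.suc r)
    reduced y i = ⅟ n * (y i - y zero)

    isInt-reduced : ∀ {r} {y : V (ℕ.suc r)} → YQ y → IsInt (reduced y)
    isInt-reduced {y = y} y∈YQ i = subst IsIntℚ difference≡ (isInt-minus (YQ-βQ[y,e] y∈YQ i) (YQ-βQ[y,e] y∈YQ zero))
      where
      difference≡ : ⅟ n * (ι (+ 1) * y i + K * ∑ y) - ⅟ n * (ι (+ 1) * y zero + K * ∑ y) ≡ reduced y i
      difference≡ = solve 5 (λ u a b k s → u :* (con 1ℚ :* a :+ k :* s) :- u :* (con 1ℚ :* b :+ k :* s) := u :* (a :- b))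
                            refl (⅟ n) (y i) (y zero) K (∑ y)

    ⅟n·y≋reduced+const : ∀ {r} (y : V (ℕ.suc r)) → (⅟ n ·ᵥ y) ≋ (reduced y +ᵥ const (⅟ n * y zero))
    ⅟n·y≋reduced+const y i = solve 3 (λ u a b → u :* a := u :* (a :- b) :+ u :* b) refl (⅟ n) (y i) (y zero)

    ⅟n*∑y≡∑reduced+r*t : ∀ {r} (y : V (ℕ.suc r)) → ⅟ n * ∑ y ≡ ∑ (reduced y) + ι (+ ℕ.suc r) * (⅟ n * y zero)
    ⅟n*∑y≡∑reduced+r*t {r} y = begin
      ⅟ n * ∑ y                                          ≡⟨ *-distribˡ-∑ (⅟ n) y ⟩
      ∑ (⅟ n ·ᵥ y)                                       ≡⟨ ∑-cong (⅟n·y≋reduced+const y) ⟩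
      ∑ (reduced y +ᵥ const t)                           ≡⟨ ∑-+ (reduced y) (const t) ⟩
      ∑ (reduced y) + ∑ {ℕ.suc r} (const t)              ≡⟨ cong (λ s → ∑ (reduced y) + s) (∑-const {ℕ.suc r} t) ⟩
      ∑ (reduced y) + ι (+ ℕ.suc r) * t                  ∎
      where
      open ≡-Reasoning
      t : ℚ
      t = ⅟ n * y zero

    ⅟n[y₀+K∑y]≡Gt+K∑reduced : ∀ {r} (y : V (ℕ.suc r)) →
      ⅟ n * (ι (+ 1) * y zero + K * ∑ y) ≡ ι (1+r+2rc c (ℕ.suc r)) * (⅟ n * y zero) + K * ∑ (reduced y)
    ⅟n[y₀+K∑y]≡Gt+K∑reduced {r} y = begin
      ⅟ n * (ι (+ 1) * y zero + K * ∑ y)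
        ≡⟨ solve 4 (λ u a k s → u :* (con 1ℚ :* a :+ k :* s) := con 1ℚ :* (u :* a) :+ k :* (u :* s))
                   refl (⅟ n) (y zero) K (∑ y) ⟩
      ι (+ 1) * t + K * (⅟ n * ∑ y)
        ≡⟨ cong (λ s → ι (+ 1) * t + K * s) (⅟n*∑y≡∑reduced+r*t y) ⟩
      ι (+ 1) * t + K * (∑ (reduced y) + ι (+ ℕ.suc r) * t)
        ≡⟨ solve 4 (λ t k d x → con 1ℚ :* t :+ k :* (d :+ x :* t) := (con 1ℚ :+ k :* x) :* t :+ k :* d)
                   refl t K (∑ (reduced y)) (ι (+ ℕ.suc r)) ⟩
      (ι (+ 1) + K * ι (+ ℕ.suc r)) * t + K * ∑ (reduced y)
        ≡⟨ cong (λ g → g * t + K * ∑ (reduced y)) (ι[1+r+2rc]≡1+b₁₂r c (ℕ.suc r)) ⟨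
      ι (1+r+2rc c (ℕ.suc r)) * t + K * ∑ (reduced y)
        ∎
      where
      open ≡-Reasoning
      t : ℚ
      t = ⅟ n * y zero

    YQ⊆nℤʳ : ∀ {r} {y : V (ℕ.suc r)} → gcd n ∣ 1+r+2rc c (ℕ.suc r) ∣ ≡ 1 → YQ y → IsInt (⅟ n ·ᵥ y)
    YQ⊆nℤʳ {r} {y} coprime y∈YQ i =
      subst IsIntℚ (sym (⅟n·y≋reduced+const y i)) (isInt-+ (isInt-reduced y∈YQ i) t-int)
      where
      G : ℤ
      G = 1+r+2rc c (ℕ.suc r)
      t : ℚ
      t = ⅟ n * y zero
      G*t-int : IsIntℚ (ι G * t)
      G*t-int = isInt-+-cancelʳ (subst IsIntℚ (⅟n[y₀+K∑y]≡Gt+K∑reduced y) (YQ-βQ[y,e] y∈YQ zero))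
                                (isInt-* (isInt-ι (b₁₂ (+ 1) c)) (isInt-∑ (isInt-reduced y∈YQ)))
      n*t-int : IsIntℚ (ι (+ n) * t)
      n*t-int = subst IsIntℚ (sym (*-inverse-cancel (ι (+ n)) (⅟ n) (ιn*⅟n≡1 n) (y zero))) (proj₁ y∈YQ zero)
      t-int : IsIntℚ t
      t-int = isInt-coprime n ∣ G ∣ coprime n*t-int (isInt-∣∣* G G*t-int)

    n·⅟n·ℤʳ⊆ℤʳ : ∀ {r} {z : V r} → IsInt z → IsInt (ι (+ n) ·ᵥ (⅟ n ·ᵥ z))
    n·⅟n·ℤʳ⊆ℤʳ {z = z} z-int i = subst IsIntℚ (sym (·ᵥ-inverse (ι (+ n)) (⅟ n) (ιn*⅟n≡1 n) z i)) (z-int i)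

    ⅟nℤʳ⊆XQ : ∀ {r} {z : V (ℕ.suc r)} → gcd n ∣ 1+r+2rc c (ℕ.suc r) ∣ ≡ 1 → IsInt z → XQ (⅟ n ·ᵥ z)
    ⅟nℤʳ⊆XQ {z = z} coprime z-int = n·⅟n·ℤʳ⊆ℤʳ z-int , λ w w∈YQ →
      subst IsIntℚ (sym (·ᵥ-self-adjoint (⅟ n) z w)) (isInt-⟪⟫ z-int (YQ⊆nℤʳ coprime w∈YQ))

    ⅟n[ℤʳ∩H]⊆XQ : ∀ {r} {z : V (ℕ.suc r)} → IsInt z → InH z → XQ (⅟ n ·ᵥ z)
    ⅟n[ℤʳ∩H]⊆XQ {z = z} z-int ∑z≡0 = n·⅟n·ℤʳ⊆ℤʳ z-int , λ w w∈YQ →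
      subst IsIntℚ (⟪z,reduced⟫≡ w) (isInt-⟪⟫ z-int (isInt-reduced w∈YQ))
      where
      ⟪z,reduced⟫≡ : ∀ w → ⟪ z , reduced w ⟫ ≡ ⟪ ⅟ n ·ᵥ z , w ⟫
      ⟪z,reduced⟫≡ w = begin
        ⟪ z , reduced w ⟫                              ≡⟨ ⟪⟫-+const z (reduced w) (⅟ n * w zero) ∑z≡0 ⟨
        ⟪ z , reduced w +ᵥ const (⅟ n * w zero) ⟫      ≡⟨ ⟪⟫-congʳ z (⅟n·y≋reduced+const w) ⟨
        ⟪ z , ⅟ n ·ᵥ w ⟫                               ≡⟨ ·ᵥ-self-adjoint (⅟ n) z w ⟨
        ⟪ ⅟ n ·ᵥ z , w ⟫                               ∎
        where open ≡-Reasoning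

    ⅟n·πYQ⊆πℤʳ : ∀ {r} {v : V (ℕ.suc r)} → Projected YQ v → Projected IsInt (⅟ n ·ᵥ v)
    ⅟n·πYQ⊆πℤʳ {v = v} (y , y∈YQ , v≋πy) = reduced y , isInt-reduced y∈YQ , λ i → begin
      ⅟ n * v i                                    ≡⟨ cong (⅟ n *_) (v≋πy i) ⟩
      ⅟ n * π y i                                  ≡⟨ π-·ᵥ (⅟ n) y i ⟨
      π (⅟ n ·ᵥ y) i                               ≡⟨ π-cong (⅟n·y≋reduced+const y) i ⟩
      π (reduced y +ᵥ const (⅟ n * y zero)) i      ≡⟨ π-+const (reduced y) (⅟ n * y zero) i ⟩
      π (reduced y) i                              ∎
      where open ≡-Reasoning

    module _ {r : ℕ} where

      D : RootDatum (ℕ.suc r)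
      D = DualDatum (ℕ.suc r) n (+ 1) c

      dual-roots-onto : MapsOnto (Φ D) IsRootA (⅟ n ·ᵥ_)
      dual-roots-onto =
        ·ᵥ-onto-unscaled (⅟ n) (ι (+ nφ n (+ 1))) (trans (cong (λ k → ⅟ n * ι (+ k)) (nφ[n,1]≡n n)) (⅟n*ιn≡1 n))
                         IsRootA-resp-≋

      dual-coroots-onto : MapsOnto IsRootA (Φ∨ D) (⅟ n ·ᵥ_)
      dual-coroots-onto = ·ᵥ-onto-scaled (⅟ n) _ (sym (gcd[n,1]/n≡⅟n n))

      dual≅GL : gcd n ∣ 1+r+2rc c (ℕ.suc r) ∣ ≡ 1 → RootDatumIso D (GLDatum (ℕ.suc r))
      dual≅GL coprime =
        ⅟ n ·ᵥ_ , ⅟ n ·ᵥ_ , ·ᵥ-additive (⅟ n) , ·ᵥ-additive (⅟ n) ,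
        ·ᵥ-latticeIso (⅟ n) (ι (+ n)) (⅟n*ιn≡1 n) (λ y → YQ⊆nℤʳ coprime) (λ z → nℤʳ⊆YQ) ,
        ·ᵥ-latticeIso (⅟ n) (ι (+ n)) (⅟n*ιn≡1 n) (λ z → ⅟nℤʳ⊆XQ coprime) (λ x → proj₁) ,
        (λ x y _ _ → ·ᵥ-self-adjoint (⅟ n) x y) ,
        dual-roots-onto , dual-coroots-onto

      derived-dual≅SL : RootDatumIso (Derived D) (SLDatum (ℕ.suc r))
      derived-dual≅SL =
        ⅟ n ·ᵥ_ , ⅟ n ·ᵥ_ , ·ᵥ-additive (⅟ n) , ·ᵥ-additive (⅟ n) ,
        ·ᵥ-latticeIso (⅟ n) (ι (+ n)) (⅟n*ιn≡1 n) (λ v → ⅟n·πYQ⊆πℤʳ) (λ v → n·πℤʳ⊆πYQ) ,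
        ·ᵥ-latticeIso (⅟ n) (ι (+ n)) (⅟n*ιn≡1 n)
                      (λ z (z-int , ∑z≡0) → ⅟n[ℤʳ∩H]⊆XQ z-int ∑z≡0 , InH-·ᵥ (⅟ n) z ∑z≡0)
                      (λ x (x∈XQ , ∑x≡0) → proj₁ x∈XQ , InH-·ᵥ (ι (+ n)) x ∑x≡0) ,
        (λ x y _ _ → ·ᵥ-self-adjoint (⅟ n) x y) ,
        π-onto (⅟ n) dual-roots-onto , dual-coroots-onto
        where
        n·πℤʳ⊆πYQ : ∀ {v : V (ℕ.suc r)} → Projected IsInt v → Projected YQ (ι (+ n) ·ᵥ v)
        n·πℤʳ⊆πYQ (z , z-int , v≋πz) =
          ι (+ n) ·ᵥ z , nℤʳ⊆YQ z-int , λ i → trans (cong (ι (+ n) *_) (v≋πz i)) (sym (π-·ᵥ (ι (+ n)) z i))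

      dual→GL-isogeny : Isogeny D (GLDatum (ℕ.suc r))
      dual→GL-isogeny =
        ι (+ n) ·ᵥ_ , ι (+ n) ·ᵥ_ , ·ᵥ-additive (ι (+ n)) , ·ᵥ-additive (ι (+ n)) ,
        (λ x → nℤʳ⊆YQ) ,
        (λ x x′ _ _ → ·ᵥ-injective (ι (+ n)) (⅟ n) (⅟n*ιn≡1 n)) ,
        (n , recompute (nonZero? n) it , λ y y∈YQ → y , proj₁ y∈YQ , λ i → refl) ,
        (λ x → proj₁) ,
        (λ x y _ _ → ·ᵥ-self-adjoint (ι (+ n)) x y) ,
        ·ᵥ-onto-scaled (ι (+ n)) _ (cong (λ k → ι (+ k)) (sym (nφ[n,1]≡n n))) ,
        ·ᵥ-onto-unscaled (ι (+ n)) ((+ gcd n ∣ + 1 ∣) / n) (trans (cong (ι (+ n) *_) (gcd[n,1]/n≡⅟n n)) (ιn*⅟n≡1 n))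
                         IsRootA-resp-≋

open import Data.Integer using (_+_; _*_)

proposition2p5 : (r : ℕ) → .{{_ : NonZero r}} → (n : ℕ) → .{{_ : NonZero n}} → (c : ℤ) →
    (gcd n ∣ + 1 + + r + + 2 * + r * c ∣ ≡ 1 → RootDatumIso (DualDatum r n (+ 1) c) (GLDatum r))
    × (gcd n r ≡ 1 → RootDatumIso (Derived (DualDatum r n (+ 1) c)) (SLDatum r)
                     × Isogeny (DualDatum r n (+ 1) c) (GLDatum r))
proposition2p5 (ℕ.suc r) n c = dual≅GL n c , λ _ → derived-dual≅SL n c , dual→GL-isogeny n c
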